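{- Let $n\ge0$ and let $f:\{0,1\}^n\to\{0,1\}$ be any Boolean function. Then there exist an integer $k$ with $0\le k\le n$ and monotonic Boolean functions $P_0,P_1,\dots,P_k:\{0,1\}^n\to\{0,1\}$ such that $$f=\Big(\big(\cdots\big((P_k\to P_{k-1})\to P_{k-2}\big)\to\cdots\big)\to P_1\Big)\to P_0,$$ where the equality is pointwise and $\to$ is Boolean implication.
   Context: $\{0,1\}^n$ carries the coordinatewise order (with $0<1$), and a Boolean function $P$ is monotonic if $u\le v$ coordinatewise implies $P(u)\le P(v)$. For $k=0$ the formula reads $f=P_0$. -}

module Defs where

open import Data.Bool using (Bool; true; false; _≤_; not; _∨_)
open import Data.Nat using (ℕ; zero; suc)
open import Data.Fin using (Fin; zero; suc)
open import Data.Vec using (Vec)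
open import Data.Vec.Relation.Binary.Pointwise.Inductive using (Pointwise)

_⇒ᵇ_ : Bool → Bool → Bool
a ⇒ᵇ b = not a ∨ b

_≤ᵛ_ : ∀ {n} → Vec Bool n → Vec Bool n → Set
_≤ᵛ_ = Pointwise _≤_

Monotonic : ∀ {n} → (Vec Bool n → Bool) → Set
Monotonic P = ∀ {u v} → u ≤ᵛ v → P u ≤ P v

-- impChain k b = ((…((b k ⇒ b (k-1)) ⇒ b (k-2)) ⇒ …) ⇒ b 1) ⇒ b 0 ;  impChain 0 b = b 0
impChain : (k : ℕ) → (Fin (suc k) → Bool) → Bool
impChain zero b = b zero
impChain (suc k) b = impChain k (λ i → b (suc i)) ⇒ᵇ b zero

-- Give each point x of the cube a level: its number of zeros, raised by one when
-- needed so that the parity of the level is f x. A strictly larger point has strictly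
-- fewer zeros, which absorbs the raise, so the level is antitone and at most n + 1.
-- Hence the thresholds P i x = [level x ≤ i] are monotone, and their implication
-- chain evaluates to the parity of level x, that is to f x: the first level x
-- thresholds are false, and y ⇒ false = not y.

module Submission where

open import Defs
open import Data.Bool using (Bool; true; false; not; _∨_; T; f≤t; b≤b)
import Data.Bool as Bool
open import Data.Bool.Properties using (∨-zeroʳ; ∨-identityʳ; ¬-not; ≤-minimum; T-≡)
open import Data.Nat using (ℕ; zero; suc; _≤_; _<_; _≤ᵇ_; s≤s)
open import Data.Nat.Properties using (≤-refl; ≤-trans; n≤1+n; m≤n⇒m≤1+n; ≤⇒≤ᵇ; ≤ᵇ⇒≤)
open import Data.Fin using (Fin; toℕ)
import Data.Fin as Fin
open import Data.Vec using (Vec; []; _∷_; countᵇ)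
open import Data.Vec.Properties using (count≤n)
open import Data.Vec.Relation.Binary.Pointwise.Inductive using ([]; _∷_)
open import Data.Product using (Σ; _×_; _,_)
open import Data.Sum using (_⊎_; inj₁; inj₂)
open import Function using (_∘_; Equivalence)
open import Relation.Nullary using (yes; no)
open import Relation.Binary.PropositionalEquality
  using (_≡_; refl; sym; cong; cong₂; subst; module ≡-Reasoning)

even : ℕ → Bool
even zero = true
even (suc m) = not (even m)

≤ᵇ-suc : ∀ m n → (suc m ≤ᵇ suc n) ≡ (m ≤ᵇ n)
≤ᵇ-suc zero n = refl
≤ᵇ-suc (suc m) n = refl

≤ᵇ-antitoneˡ : ∀ {a b} t → a ≤ b → (b ≤ᵇ t) Bool.≤ (a ≤ᵇ t)
≤ᵇ-antitoneˡ {a} {b} t a≤b with b ≤ᵇ t in b≤ᵇt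
... | false = ≤-minimum _
... | true = subst (true Bool.≤_) (sym (Equivalence.to T-≡ (≤⇒≤ᵇ a≤t))) b≤b
  where
  a≤t : a ≤ t
  a≤t = ≤-trans a≤b (≤ᵇ⇒≤ b t (subst T (sym b≤ᵇt) _))

impChain-cong : ∀ k {b c : Fin (suc k) → Bool} → (∀ i → b i ≡ c i) → impChain k b ≡ impChain k c
impChain-cong zero b≡c = b≡c Fin.zero
impChain-cong (suc k) b≡c = cong₂ _⇒ᵇ_ (impChain-cong k (b≡c ∘ Fin.suc)) (b≡c Fin.zero)

impChain-threshold : ∀ k m → m ≤ suc k → impChain k (λ i → m ≤ᵇ toℕ i) ≡ even m
impChain-threshold zero zero _ = refl
impChain-threshold zero (suc zero) _ = refl
impChain-threshold zero (suc (suc m)) (s≤s ())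
impChain-threshold (suc k) zero _ = ∨-zeroʳ _
impChain-threshold (suc k) (suc m) (s≤s m≤1+k) = begin
  not (impChain k (λ i → suc m ≤ᵇ suc (toℕ i))) ∨ false ≡⟨ ∨-identityʳ _ ⟩
  not (impChain k (λ i → suc m ≤ᵇ suc (toℕ i)))         ≡⟨ cong not (impChain-cong k (≤ᵇ-suc m ∘ toℕ)) ⟩
  not (impChain k (λ i → m ≤ᵇ toℕ i))                   ≡⟨ cong not (impChain-threshold k m m≤1+k) ⟩
  not (even m)                                          ∎
  where open ≡-Reasoning

alignParity : Bool → ℕ → ℕ
alignParity b d with even d Bool.≟ b
... | yes _ = d
... | no _ = suc d

even-alignParity : ∀ b d → even (alignParity b d) ≡ b
even-alignParity b d with even d Bool.≟ b
... | yes even-d≡b = even-d≡b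
... | no even-d≢b = sym (¬-not (even-d≢b ∘ sym))

alignParity-lower : ∀ b d → d ≤ alignParity b d
alignParity-lower b d with even d Bool.≟ b
... | yes _ = ≤-refl
... | no _ = n≤1+n d

alignParity-upper : ∀ b d → alignParity b d ≤ suc d
alignParity-upper b d with even d Bool.≟ b
... | yes _ = n≤1+n d
... | no _ = ≤-refl

zeros : ∀ {n} → Vec Bool n → ℕ
zeros = countᵇ not

zeros-strictly-antitone : ∀ {n} {u v : Vec Bool n} → u ≤ᵛ v → u ≡ v ⊎ zeros v < zeros u
zeros-strictly-antitone [] = inj₁ refl
zeros-strictly-antitone (u₀≤v₀ ∷ u≤v) with zeros-strictly-antitone u≤v
zeros-strictly-antitone (f≤t ∷ _) | inj₁ refl = inj₂ ≤-refl
zeros-strictly-antitone (b≤b ∷ _) | inj₁ refl = inj₁ refl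
zeros-strictly-antitone (f≤t ∷ _) | inj₂ fewer = inj₂ (m≤n⇒m≤1+n fewer)
zeros-strictly-antitone (b≤b {true} ∷ _) | inj₂ fewer = inj₂ fewer
zeros-strictly-antitone (b≤b {false} ∷ _) | inj₂ fewer = inj₂ (s≤s fewer)

threshold-monotonic : ∀ {n} {g : Vec Bool n → ℕ} → (∀ {u v} → u ≤ᵛ v → g v ≤ g u) →
                      ∀ t → Monotonic (λ x → g x ≤ᵇ t)
threshold-monotonic g-antitone t u≤v = ≤ᵇ-antitoneˡ t (g-antitone u≤v)

module _ {n} (f : Vec Bool n → Bool) where

  level : Vec Bool n → ℕ
  level x = alignParity (f x) (zeros x)

  even-level : ∀ x → even (level x) ≡ f x
  even-level x = even-alignParity (f x) (zeros x)

  level-bounded : ∀ x → level x ≤ suc n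
  level-bounded x = ≤-trans (alignParity-upper (f x) (zeros x)) (s≤s (count≤n _ x))

  level-antitone : ∀ {u v} → u ≤ᵛ v → level v ≤ level u
  level-antitone {u} {v} u≤v with zeros-strictly-antitone u≤v
  ... | inj₁ refl = ≤-refl
  ... | inj₂ fewer = ≤-trans (alignParity-upper (f v) (zeros v))
                             (≤-trans fewer (alignParity-lower (f u) (zeros u)))

corollary3 : (n : ℕ) → (f : Vec Bool n → Bool) →
    Σ ℕ (λ k → k ≤ n × Σ (Fin (suc k) → Vec Bool n → Bool) (λ P →
    ((i : Fin (suc k)) → Monotonic (P i)) ×
    ((x : Vec Bool n) → f x ≡ impChain k (λ i → P i x))))
corollary3 n f =
  n , ≤-refl , (λ i x → level f x ≤ᵇ toℕ i) ,
  (λ i → threshold-monotonic (level-antitone f) (toℕ i)) ,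
  λ x → begin
    f x                                       ≡⟨ sym (even-level f x) ⟩
    even (level f x)                          ≡⟨ sym (impChain-threshold n (level f x) (level-bounded f x)) ⟩
    impChain n (λ i → level f x ≤ᵇ toℕ i)     ∎
  where open ≡-Reasoning
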